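{- Let $n>2$, $i\neq j$ in $\{1,\dots,n\}$, let $I(j,i)$ be the $n\times n$ identity matrix with its $(j,i)$ entry replaced by $-1$, and $T_{ij}=I(j,i)_{(i)(j)}$. Then: 1. $I_{(i)(j)}T_{ij}^{ -1}$ (with $I$ the $n\times n$ identity) is obtained from $I_{(n-1)\times(n-1)}$ by replacing its $(k,k)$ entry with $0$, where $k=j$ if $j<i$ and $k=j-1$ if $j>i$; 2. $I_{(i)(j)}T_{ij}^{ -1}I_{(i)(j)}=I_{(i)(j)}$, i.e. $T_{ij}^{ -1}$ is a generalized inverse of $I_{(i)(j)}$.
   Context: For an $n\times n$ matrix $M$, $M_{(u)(v)}$ denotes the matrix obtained by deleting row $u$ and column $v$, remaining rows and columns keeping their original order. -}

module Defs where

open import Data.Nat using (ℕ; zero; suc)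
open import Data.Fin using (Fin; zero; suc; punchIn; _≟_)
open import Data.Integer using (ℤ; _+_; _*_; -_; 0ℤ; 1ℤ)
open import Relation.Nullary using (yes; no)
open import Relation.Binary.PropositionalEquality using (_≡_)

-- Matrices with m rows and n columns, integer entries (0-based indices).
Matrix : ℕ → ℕ → Set
Matrix m n = Fin m → Fin n → ℤ

∑ : ∀ {n} → (Fin n → ℤ) → ℤ
∑ {zero}  f = 0ℤ
∑ {suc n} f = f zero + ∑ (λ a → f (suc a))

_⊗_ : ∀ {m n p} → Matrix m n → Matrix n p → Matrix m p
(A ⊗ B) a c = ∑ (λ b → A a b * B b c)

_≐_ : ∀ {m n} → Matrix m n → Matrix m n → Set
A ≐ B = ∀ a b → A a b ≡ B a b

Id : ∀ n → Matrix n n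
Id n a b with a ≟ b
... | yes _ = 1ℤ
... | no  _ = 0ℤ

IdZeroAt : ∀ n → Fin n → Matrix n n
IdZeroAt n k a b with a ≟ k | b ≟ k
... | yes _ | yes _ = 0ℤ
... | _     | _     = Id n a b

Iji : ∀ n → Fin n → Fin n → Matrix n n
Iji n j i a b with a ≟ j | b ≟ i
... | yes _ | yes _ = - 1ℤ
... | _     | _     = Id n a b

-- M_(u)(v): delete row u and column v, keeping the order of the others
-- (punchIn u : Fin n → Fin (suc n) is the order-preserving injection skipping u).
del : ∀ {n} → Matrix (suc n) (suc n) → Fin (suc n) → Fin (suc n) → Matrix n n
del M u v a b = M (punchIn u a) (punchIn v b)

T : ∀ {n} → Fin (suc n) → Fin (suc n) → Matrix n n
T {n} i j = del (Iji (suc n) j i) i j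

IsInverse : ∀ {n} → Matrix n n → Matrix n n → Set
IsInverse {n} M S = ((M ⊗ S) ≐ Id n) × ((S ⊗ M) ≐ Id n)
  where open import Data.Product using (_×_)

module Submission where

-- T_ij is a signed permutation matrix: deleting row i and column j of
-- I(j,i) leaves exactly one entry ±1 in every row and column, placed along
-- the permutation obtained from the transposition (i j) by removing i.
-- A signed permutation matrix is inverted by its transpose, which gives
-- the inverse S of T_ij.  For the remaining claims, write k for the row of
-- I_(i)(j) coming from row j of I (so punchIn i k = j).  I_(i)(j) is T_ij
-- with row k replaced by zeros, since I and I(j,i) differ only in row j,
-- and row k of I_(i)(j) is zero because its one nonzero entry sat in the
-- deleted column j.  As zeroing a row commutes with multiplication on the
-- right, I_(i)(j) S is the identity with row k zeroed (part 1), and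
-- multiplying this by I_(i)(j) again returns I_(i)(j) (part 2).

open import Defs
open import Data.Nat using (ℕ; suc; _<_; _∸_)
open import Data.Fin using (Fin; toℕ)
open import Data.Product using (_×_; ∃)
open import Relation.Binary.PropositionalEquality using (_≡_; _≢_)

open import Data.Nat using (zero; s≤s; _≤_)
import Data.Nat.Properties as ℕₚ
open import Data.Fin using (zero; suc; punchIn; punchOut; _≟_)
open import Data.Fin.Properties
  using (punchIn-injective; punchInᵢ≢i; punchIn-punchOut; toℕ-injective; suc-injective)
open import Data.Fin.Permutation
  using (Permutation′; _⟨$⟩ʳ_; _⟨$⟩ˡ_; inverseˡ; inverseʳ; flip; remove; transpose; punchIn-permute)
import Data.Fin.Permutation.Components as Swap
open import Data.Integer using (ℤ; 0ℤ; 1ℤ; -_; _+_; _*_)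
open import Data.Integer.Properties using (*-zeroˡ; *-zeroʳ; *-identityˡ; +-identityˡ; +-identityʳ)
open import Data.Product using (_,_)
open import Data.Sum using (_⊎_; inj₁; inj₂)
open import Data.Empty using (⊥-elim)
open import Function using (_∘_)
open import Level using (0ℓ)
open import Relation.Nullary using (Dec; yes; no)
open import Relation.Nullary.Decidable using (dec-true; dec-false)
open import Relation.Binary.Bundles using (Setoid)
open import Relation.Binary.Definitions using (tri<; tri≈; tri>)
open import Relation.Binary.PropositionalEquality
  using (refl; sym; trans; cong; cong₂; subst; module ≡-Reasoning)

∑-cong : ∀ {n} {f g : Fin n → ℤ} → (∀ b → f b ≡ g b) → ∑ f ≡ ∑ g
∑-cong {zero}  f≗g = refl
∑-cong {suc n} f≗g = cong₂ _+_ (f≗g zero) (∑-cong (f≗g ∘ suc))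

∑-zero : ∀ {n} {f : Fin n → ℤ} → (∀ b → f b ≡ 0ℤ) → ∑ f ≡ 0ℤ
∑-zero {zero}  f≗0 = refl
∑-zero {suc n} f≗0 = cong₂ _+_ (f≗0 zero) (∑-zero (f≗0 ∘ suc))

∑-single : ∀ {n} {f : Fin n → ℤ} (b₀ : Fin n) → (∀ b → b ≢ b₀ → f b ≡ 0ℤ) → ∑ f ≡ f b₀
∑-single {suc n} {f} zero others =
  trans (cong (f zero +_) (∑-zero (λ b → others (suc b) (λ ())))) (+-identityʳ (f zero))
∑-single {suc n} {f} (suc b₀) others =
  trans (cong (_+ ∑ (f ∘ suc)) (others zero (λ ())))
    (trans (+-identityˡ _) (∑-single b₀ (λ b b≢b₀ → others (suc b) (b≢b₀ ∘ suc-injective))))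

≐-setoid : ℕ → ℕ → Setoid 0ℓ 0ℓ
≐-setoid m n = record
  { Carrier       = Matrix m n
  ; _≈_           = _≐_
  ; isEquivalence = record
    { refl  = λ _ _ → refl
    ; sym   = λ A≐B a b → sym (A≐B a b)
    ; trans = λ A≐B B≐C a b → trans (A≐B a b) (B≐C a b)
    }
  }

⊗-congˡ : ∀ {m n p} {A A′ : Matrix m n} (C : Matrix n p) → A ≐ A′ → (A ⊗ C) ≐ (A′ ⊗ C)
⊗-congˡ C A≐A′ a c = ∑-cong (λ b → cong (_* C b c) (A≐A′ a b))

Id-diag : ∀ n (a : Fin n) → Id n a a ≡ 1ℤ
Id-diag n a with a ≟ a
... | yes _   = refl
... | no  a≢a = ⊥-elim (a≢a refl)

Id-off : ∀ n {a b : Fin n} → a ≢ b → Id n a b ≡ 0ℤ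
Id-off n {a} {b} a≢b with a ≟ b
... | yes a≡b = ⊥-elim (a≢b a≡b)
... | no  _   = refl

Id-⊗ : ∀ {n p} (A : Matrix n p) → (Id n ⊗ A) ≐ A
Id-⊗ {n} A a c = begin
  ∑ (λ b → Id n a b * A b c) ≡⟨ ∑-single a (λ b b≢a → cong (_* A b c) (Id-off n (b≢a ∘ sym))) ⟩
  Id n a a * A a c           ≡⟨ cong (_* A a c) (Id-diag n a) ⟩
  1ℤ * A a c                 ≡⟨ *-identityˡ (A a c) ⟩
  A a c                      ∎
  where open ≡-Reasoning

_ᵀ : ∀ {m n} → Matrix m n → Matrix n m
(M ᵀ) a b = M b a

-- A signed permutation matrix: all entries off the graph of π vanish and
-- the entries on it square to 1 (so they are ±1).

record IsSignedPermutation {m} (M : Matrix m m) (π : Permutation′ m) : Set where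
  field
    off-graph : ∀ a b → b ≢ π ⟨$⟩ʳ a → M a b ≡ 0ℤ
    on-graph  : ∀ a → M a (π ⟨$⟩ʳ a) * M a (π ⟨$⟩ʳ a) ≡ 1ℤ

permute-injective : ∀ {m} (π : Permutation′ m) {a b} → π ⟨$⟩ʳ a ≡ π ⟨$⟩ʳ b → a ≡ b
permute-injective π {a} {b} πa≡πb =
  trans (sym (inverseˡ π)) (trans (cong (π ⟨$⟩ˡ_) πa≡πb) (inverseˡ π))

module _ {m} {M : Matrix m m} {π : Permutation′ m} (M-signed : IsSignedPermutation M π) where
  open IsSignedPermutation M-signed

  -- Distinct rows of M have their nonzero entries in distinct columns,
  -- so the rows are orthonormal: M Mᵀ = I.
  ⊗-transposeʳ : (M ⊗ (M ᵀ)) ≐ Id m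
  ⊗-transposeʳ a c = trans (∑-single (π ⟨$⟩ʳ a) vanish) (diagonal (a ≟ c))
    where
    vanish : ∀ b → b ≢ π ⟨$⟩ʳ a → M a b * M c b ≡ 0ℤ
    vanish b b≢πa = trans (cong (_* M c b) (off-graph a b b≢πa)) (*-zeroˡ (M c b))
    diagonal : Dec (a ≡ c) → M a (π ⟨$⟩ʳ a) * M c (π ⟨$⟩ʳ a) ≡ Id m a c
    diagonal (yes refl) = trans (on-graph a) (sym (Id-diag m a))
    diagonal (no  a≢c)  = trans
      (trans (cong (M a (π ⟨$⟩ʳ a) *_) (off-graph c (π ⟨$⟩ʳ a) (a≢c ∘ permute-injective π)))
             (*-zeroʳ (M a (π ⟨$⟩ʳ a))))
      (sym (Id-off m a≢c))

  transpose-signed : IsSignedPermutation (M ᵀ) (flip π)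
  transpose-signed = record
    { off-graph = λ a b b≢π⁻¹a → off-graph b a (λ a≡πb →
        b≢π⁻¹a (trans (sym (inverseˡ π)) (cong (π ⟨$⟩ˡ_) (sym a≡πb))))
    ; on-graph  = λ a → subst (λ c → M (π ⟨$⟩ˡ a) c * M (π ⟨$⟩ˡ a) c ≡ 1ℤ)
        (inverseʳ π) (on-graph (π ⟨$⟩ˡ a))
    }

signed-permutation-inverse : ∀ {m} {M : Matrix m m} {π : Permutation′ m} →
  IsSignedPermutation M π → IsInverse M (M ᵀ)
signed-permutation-inverse M-signed = ⊗-transposeʳ M-signed , ⊗-transposeʳ (transpose-signed M-signed)

del-signed : ∀ {m} (M : Matrix (suc m) (suc m)) (π : Permutation′ (suc m)) (i : Fin (suc m)) →
  (∀ x y → x ≢ i → y ≢ π ⟨$⟩ʳ i → y ≢ π ⟨$⟩ʳ x → M x y ≡ 0ℤ) →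
  (∀ x → x ≢ i → M x (π ⟨$⟩ʳ x) * M x (π ⟨$⟩ʳ x) ≡ 1ℤ) →
  IsSignedPermutation (del M i (π ⟨$⟩ʳ i)) (remove i π)
del-signed M π i off-graph on-graph = record
  { off-graph = λ a b b≢σa → off-graph (punchIn i a) (punchIn (π ⟨$⟩ʳ i) b)
      (punchInᵢ≢i i a) (punchInᵢ≢i (π ⟨$⟩ʳ i) b)
      (λ e → b≢σa (punchIn-injective (π ⟨$⟩ʳ i) _ _ (trans e (punchIn-permute π i a))))
  ; on-graph  = λ a → subst (λ y → M (punchIn i a) y * M (punchIn i a) y ≡ 1ℤ)
      (punchIn-permute π i a) (on-graph (punchIn i a) (punchInᵢ≢i i a))
  }

swap-left : ∀ {n} (i j : Fin n) → Swap.transpose i j i ≡ j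
swap-left i j rewrite dec-true (i ≟ i) refl = refl

swap-right : ∀ {n} (i j : Fin n) → Swap.transpose i j j ≡ i
swap-right i j with j ≟ i
... | yes j≡i = j≡i
... | no  _   rewrite dec-true (j ≟ j) refl = refl

swap-fixed : ∀ {n} {i j x : Fin n} → x ≢ i → x ≢ j → Swap.transpose i j x ≡ x
swap-fixed {i = i} {j} {x} x≢i x≢j rewrite dec-false (x ≟ i) x≢i | dec-false (x ≟ j) x≢j = refl

Iji-corner : ∀ n (j i : Fin n) → Iji n j i j i ≡ - 1ℤ
Iji-corner n j i with j ≟ j | i ≟ i
... | yes _   | yes _   = refl
... | no  j≢j | _       = ⊥-elim (j≢j refl)
... | yes _   | no  i≢i = ⊥-elim (i≢i refl)

Iji-away : ∀ n {j i x y : Fin n} → x ≢ j ⊎ y ≢ i → Iji n j i x y ≡ Id n x y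
Iji-away n {j} {i} {x} {y} away with x ≟ j | y ≟ i
Iji-away n (inj₁ x≢j) | yes x≡j | yes _   = ⊥-elim (x≢j x≡j)
Iji-away n (inj₂ y≢i) | yes _   | yes y≡i = ⊥-elim (y≢i y≡i)
... | yes _ | no _ = refl
... | no  _ | _    = refl

-- T_ij is a signed permutation matrix along the transposition (i j) with
-- i removed: row j of I(j,i) keeps only its entry -1 in column i once
-- column j is deleted, and every other surviving row is a row of I.

T-signed : ∀ {m} (i j : Fin (suc m)) → IsSignedPermutation (T i j) (remove i (transpose i j))
T-signed {m} i j = subst (λ v → IsSignedPermutation (del (Iji (suc m) j i) i v) (remove i (transpose i j)))
  (swap-left i j) (del-signed (Iji (suc m) j i) (transpose i j) i off-graph on-graph)
  where
  π : Fin (suc m) → Fin (suc m)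
  π = Swap.transpose i j

  off-graph : ∀ x y → x ≢ i → y ≢ π i → y ≢ π x → Iji (suc m) j i x y ≡ 0ℤ
  off-graph x y x≢i y≢πi y≢πx = by-row (x ≟ j)
    where
    by-row : Dec (x ≡ j) → Iji (suc m) j i x y ≡ 0ℤ
    by-row (yes refl) = trans (Iji-away (suc m) (inj₂ (λ y≡i → y≢πx (trans y≡i (sym (swap-right i x))))))
                              (Id-off (suc m) (λ x≡y → y≢πi (trans (sym x≡y) (sym (swap-left i x)))))
    by-row (no x≢j)   = trans (Iji-away (suc m) (inj₁ x≢j))
                              (Id-off (suc m) (λ x≡y → y≢πx (trans (sym x≡y) (sym (swap-fixed x≢i x≢j)))))

  on-graph : ∀ x → x ≢ i → Iji (suc m) j i x (π x) * Iji (suc m) j i x (π x) ≡ 1ℤ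
  on-graph x x≢i = by-row (x ≟ j)
    where
    by-row : Dec (x ≡ j) → Iji (suc m) j i x (π x) * Iji (suc m) j i x (π x) ≡ 1ℤ
    by-row (yes refl) rewrite swap-right i x | Iji-corner (suc m) x i = refl
    by-row (no x≢j)   rewrite swap-fixed x≢i x≢j | Iji-away (suc m) {j} {i} {x} {x} (inj₁ x≢j)
                            | Id-diag (suc m) x = refl

zeroRow : ∀ {m n} → Fin m → Matrix m n → Matrix m n
zeroRow k A a b with a ≟ k
... | yes _ = 0ℤ
... | no  _ = A a b

zeroRow-at : ∀ {m n} (k : Fin m) (A : Matrix m n) b → zeroRow k A k b ≡ 0ℤ
zeroRow-at k A b with k ≟ k
... | yes _   = refl
... | no  k≢k = ⊥-elim (k≢k refl)

zeroRow-away : ∀ {m n} {k a : Fin m} (A : Matrix m n) b → a ≢ k → zeroRow k A a b ≡ A a b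
zeroRow-away {k = k} {a} A b a≢k with a ≟ k
... | yes a≡k = ⊥-elim (a≢k a≡k)
... | no  _   = refl

zeroRow-cong : ∀ {m n} (k : Fin m) {A B : Matrix m n} → A ≐ B → zeroRow k A ≐ zeroRow k B
zeroRow-cong k {A} {B} A≐B a b with a ≟ k
... | yes _ = refl
... | no  _ = A≐B a b

zeroRow-⊗ : ∀ {m n p} (k : Fin m) (A : Matrix m n) (C : Matrix n p) →
  (zeroRow k A ⊗ C) ≐ zeroRow k (A ⊗ C)
zeroRow-⊗ k A C a c = by-row (a ≟ k)
  where
  by-row : Dec (a ≡ k) → (zeroRow k A ⊗ C) a c ≡ zeroRow k (A ⊗ C) a c
  by-row (yes refl) = trans (∑-zero (λ b → trans (cong (_* C b c) (zeroRow-at a A b)) (*-zeroˡ (C b c))))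
                            (sym (zeroRow-at a (A ⊗ C) c))
  by-row (no a≢k)   = trans (∑-cong (λ b → cong (_* C b c) (zeroRow-away A b a≢k)))
                            (sym (zeroRow-away (A ⊗ C) c a≢k))

zeroRow-absorb : ∀ {m n} (k : Fin m) (A : Matrix m n) → (∀ b → A k b ≡ 0ℤ) → zeroRow k A ≐ A
zeroRow-absorb k A row-k-zero a b with a ≟ k
... | yes refl = sym (row-k-zero b)
... | no  _    = refl

IdZeroAt-zeroRow : ∀ m (k : Fin m) → IdZeroAt m k ≐ zeroRow k (Id m)
IdZeroAt-zeroRow m k a b with a ≟ k | b ≟ k
... | yes refl | yes _   = refl
... | yes refl | no  b≢k = Id-off m (b≢k ∘ sym)
... | no  _    | yes _   = refl
... | no  _    | no  _   = refl

-- Let k be the row of I_(i)(j) that comes from row j of I.  That row is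
-- zero (its entry 1 was in the deleted column j), and every other row
-- of I_(i)(j) is the corresponding row of T_ij, so I_(i)(j) is T_ij with
-- row k zeroed.

module DeletedIdentity {m} (i j : Fin (suc m)) (k : Fin m) (k↦j : punchIn i k ≡ j) where

  D : Matrix m m
  D = del (Id (suc m)) i j

  D-row-k : ∀ b → D k b ≡ 0ℤ
  D-row-k b = Id-off (suc m) (λ eq → punchInᵢ≢i j b (trans (sym eq) k↦j))

  D-zeroRow-T : D ≐ zeroRow k (T i j)
  D-zeroRow-T a b = by-row (a ≟ k)
    where
    by-row : Dec (a ≡ k) → D a b ≡ zeroRow k (T i j) a b
    by-row (yes refl) = trans (D-row-k b) (sym (zeroRow-at a (T i j) b))
    by-row (no a≢k)   = trans
      (sym (Iji-away (suc m) (inj₁ (λ eq → a≢k (punchIn-injective i a k (trans eq (sym k↦j)))))))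
      (sym (zeroRow-away (T i j) b a≢k))

  D⊗S : (S : Matrix m m) → (T i j ⊗ S) ≐ Id m → (D ⊗ S) ≐ IdZeroAt m k
  D⊗S S T⊗S≐I = begin
    D ⊗ S                   ≈⟨ ⊗-congˡ S D-zeroRow-T ⟩
    zeroRow k (T i j) ⊗ S   ≈⟨ zeroRow-⊗ k (T i j) S ⟩
    zeroRow k (T i j ⊗ S)   ≈⟨ zeroRow-cong k T⊗S≐I ⟩
    zeroRow k (Id m)        ≈⟨ IdZeroAt-zeroRow m k ⟨
    IdZeroAt m k            ∎
    where open import Relation.Binary.Reasoning.Setoid (≐-setoid m m)

  D⊗S⊗D : (S : Matrix m m) → (T i j ⊗ S) ≐ Id m → ((D ⊗ S) ⊗ D) ≐ D
  D⊗S⊗D S T⊗S≐I = begin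
    (D ⊗ S) ⊗ D             ≈⟨ ⊗-congˡ D (D⊗S S T⊗S≐I) ⟩
    IdZeroAt m k ⊗ D        ≈⟨ ⊗-congˡ D (IdZeroAt-zeroRow m k) ⟩
    zeroRow k (Id m) ⊗ D    ≈⟨ zeroRow-⊗ k (Id m) D ⟩
    zeroRow k (Id m ⊗ D)    ≈⟨ zeroRow-cong k (Id-⊗ D) ⟩
    zeroRow k D             ≈⟨ zeroRow-absorb k D D-row-k ⟩
    D                       ∎
    where open import Relation.Binary.Reasoning.Setoid (≐-setoid m m)

toℕ-punchIn-below : ∀ {m} (i : Fin (suc m)) (k : Fin m) → toℕ k < toℕ i → toℕ (punchIn i k) ≡ toℕ k
toℕ-punchIn-below (suc i) zero    _         = refl
toℕ-punchIn-below (suc i) (suc k) (s≤s k<i) = cong suc (toℕ-punchIn-below i k k<i)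

toℕ-punchIn-above : ∀ {m} (i : Fin (suc m)) (k : Fin m) → toℕ i ≤ toℕ k → toℕ (punchIn i k) ≡ suc (toℕ k)
toℕ-punchIn-above zero    k       _         = refl
toℕ-punchIn-above (suc i) (suc k) (s≤s i≤k) = cong suc (toℕ-punchIn-above i k i≤k)

punchIn-row : ∀ {m} (i j : Fin (suc m)) (k : Fin m) → i ≢ j →
  (toℕ j < toℕ i → toℕ k ≡ toℕ j) → (toℕ i < toℕ j → toℕ k ≡ toℕ j ∸ 1) → punchIn i k ≡ j
punchIn-row i j k i≢j j<i⇒k≡j i<j⇒k≡j-1 with ℕₚ.<-cmp (toℕ j) (toℕ i)
... | tri< j<i _ _ = toℕ-injective (begin
  toℕ (punchIn i k) ≡⟨ toℕ-punchIn-below i k (subst (_< toℕ i) (sym k≡j) j<i) ⟩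
  toℕ k             ≡⟨ k≡j ⟩
  toℕ j             ∎)
  where open ≡-Reasoning
        k≡j : toℕ k ≡ toℕ j
        k≡j = j<i⇒k≡j j<i
... | tri≈ _ j≡i _ = ⊥-elim (i≢j (toℕ-injective (sym j≡i)))
... | tri> _ _ i<j = toℕ-injective (begin
  toℕ (punchIn i k)   ≡⟨ toℕ-punchIn-above i k (subst (toℕ i ≤_) (sym k≡j-1) (ℕₚ.<⇒≤pred i<j)) ⟩
  suc (toℕ k)         ≡⟨ cong suc k≡j-1 ⟩
  suc (toℕ j ∸ 1)     ≡⟨ positive-suc-pred i<j ⟩
  toℕ j               ∎)
  where open ≡-Reasoning
        k≡j-1 : toℕ k ≡ toℕ j ∸ 1
        k≡j-1 = i<j⇒k≡j-1 i<j
        positive-suc-pred : ∀ {a b} → a < b → suc (b ∸ 1) ≡ b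
        positive-suc-pred (s≤s _) = refl

corollary2 : ∀ (m : ℕ) → 2 < suc m → (i j : Fin (suc m)) → i ≢ j →
    (∃ λ S → IsInverse (T i j) S) ×
    (∀ (S : Matrix m m) → IsInverse (T i j) S →
      (∀ (k : Fin m) → (toℕ j < toℕ i → toℕ k ≡ toℕ j) → (toℕ i < toℕ j → toℕ k ≡ toℕ j ∸ 1) →
        (del (Id (suc m)) i j ⊗ S) ≐ IdZeroAt m k)
      × (((del (Id (suc m)) i j ⊗ S) ⊗ del (Id (suc m)) i j) ≐ del (Id (suc m)) i j))
corollary2 m _ i j i≢j =
  (T i j ᵀ , signed-permutation-inverse (T-signed i j)) ,
  λ S (T⊗S≐I , _) →
    (λ k j<i⇒k≡j i<j⇒k≡j-1 → DeletedIdentity.D⊗S i j k (punchIn-row i j k i≢j j<i⇒k≡j i<j⇒k≡j-1) S T⊗S≐I) ,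
    DeletedIdentity.D⊗S⊗D i j (punchOut i≢j) (punchIn-punchOut i≢j) S T⊗S≐I
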